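{- Let $G$ be a graph with vertex set $\{1,\dots,n\}$ and let $\rho$ and $\sigma$ be a row map and a column map of the augmented adjacency matrix $M(G)$ such that $M(G)_{\rho,\sigma}=\overline{M_I(k')}$ for some $k'\geq3$. If the subgraph $G'$ of $G$ induced by $\{\rho(1),\dots,\rho(k'),\sigma(1),\dots,\sigma(k')\}$ is co-bipartite, then $G'$ is isomorphic to $\overline{C_{2k'}}$.
   Context: The augmented adjacency matrix $M(G)=(m_{ij})$ of a graph $G$ on $\{1,\dots,n\}$ is the $n\times n$ binary matrix with $m_{ij}=1$ iff $i=j$ or $i$ is adjacent to $j$. A row map (column map) of an $n\times n$ matrix is an injective function $[k']\to[n]$; $M_{\rho,\sigma}$ is the matrix whose $(i,j)$ entry is the $(\rho(i),\sigma(j))$ entry of $M$. For $k\ge3$, $M_I(k)$ is the $k\times k$ matrix whose row $i<k$ has ones exactly in columns $i,i+1$ and row $k$ in columns $1,k$; $\overline M$ exchanges $0$'s and $1$'s. A graph is co-bipartite if its complement is bipartite. $C_{k}$ is the chordless cycle on $k$ vertices and $\overline{C_{2k'}}$ its complement. -}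

module Defs where

open import Data.Nat using (ℕ; zero; suc; _+_; _<_; _≤_)
open import Data.Fin using (Fin; toℕ)
open import Data.Fin.Properties using (_≟_)
open import Data.Bool using (Bool; true; false; not; _∨_; T)
open import Data.Product using (Σ; ∃; _×_; _,_)
open import Data.Sum using (_⊎_)
open import Relation.Nullary using (¬_)
open import Relation.Nullary.Decidable using (⌊_⌋)
open import Relation.Binary.PropositionalEquality using (_≡_; _≢_)
open import Function.Definitions using (Injective)
open import Function.Bundles using (_⇔_)

-- A (finite simple) graph on the vertex set Fin n (= {1,…,n}, 0-indexed).
record Graph (n : ℕ) : Set where
  field
    adj   : Fin n → Fin n → Bool
    sym   : ∀ u v → adj u v ≡ adj v u
    irrefl : ∀ v → adj v v ≡ false
open Graph public

Matrix : ℕ → ℕ → Set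
Matrix r c = Fin r → Fin c → Bool

augAdj : ∀ {n} → Graph n → Matrix n n
augAdj G i j = ⌊ i ≟ j ⌋ ∨ adj G i j

RowMap : ℕ → ℕ → Set
RowMap k n = Σ (Fin k → Fin n) (λ ρ → Injective _≡_ _≡_ ρ)

subMatrix : ∀ {n k} → Matrix n n → (Fin k → Fin n) → (Fin k → Fin n) → Matrix k k
subMatrix M ρ σ i j = M (ρ i) (σ j)

compl : ∀ {r c} → Matrix r c → Matrix r c
compl M i j = not (M i j)

-- M_I(k), 0-indexed: row i (i+1 < k) has ones in columns i and i+1;
-- the last row (i+1 = k) has ones in columns 0 and k-1 (= i).
MI : (k : ℕ) → Matrix k k
MI k i j with suc (toℕ i) Data.Nat.≟ k
... | Relation.Nullary.yes _ = ⌊ toℕ j Data.Nat.≟ 0 ⌋ ∨ ⌊ toℕ j Data.Nat.≟ toℕ i ⌋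
... | Relation.Nullary.no _  = ⌊ toℕ j Data.Nat.≟ toℕ i ⌋ ∨ ⌊ toℕ j Data.Nat.≟ suc (toℕ i) ⌋

InImage : ∀ {n k} → (Fin k → Fin n) → (Fin k → Fin n) → Fin n → Set
InImage ρ σ v = (∃ λ i → ρ i ≡ v) ⊎ (∃ λ j → σ j ≡ v)

-- The subgraph of G induced by S (predicate on vertices) is co-bipartite:
-- its complement is bipartite, i.e. there is a 2-colouring of S such that
-- any two distinct non-adjacent vertices of S get different colours.
CoBipartiteOn : ∀ {n} → Graph n → (Fin n → Set) → Set
CoBipartiteOn {n} G S =
  ∃ λ (c : Fin n → Bool) →
    ∀ u v → S u → S v → u ≢ v → adj G u v ≡ false → c u ≢ c v

CycleAdj : (m : ℕ) → Fin m → Fin m → Set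
CycleAdj m a b =
    (toℕ b ≡ suc (toℕ a)) ⊎ (toℕ a ≡ suc (toℕ b))
  ⊎ (toℕ a ≡ 0 × suc (toℕ b) ≡ m) ⊎ (toℕ b ≡ 0 × suc (toℕ a) ≡ m)

CoCycleAdj : (m : ℕ) → Fin m → Fin m → Set
CoCycleAdj m a b = a ≢ b × ¬ CycleAdj m a b

InducedIsoCoCycle : ∀ {n} → Graph n → (Fin n → Set) → ℕ → Set
InducedIsoCoCycle {n} G S m =
  ∃ λ (f : Fin m → Fin n) →
      Injective _≡_ _≡_ f
    × (∀ v → S v ⇔ (∃ λ a → f a ≡ v))
    × (∀ a b → T (adj G (f a) (f b)) ⇔ CoCycleAdj m a b)

-- An entry 1 of M_I(k') at (i,j) forces ρ(i) and σ(j) to be distinct and non-adjacent, hence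
-- differently coloured in any 2-colouring of the complement of G'. The ones at (i,i) and (i,i+1)
-- make σ(i) and σ(i+1) both opposite to ρ(i), so all ρ(i) share one colour and all σ(j) the other.
-- Consequently the ρ(i) and the σ(j) form two disjoint cliques, and ρ(i) ~ σ(j) exactly when M_I(k')
-- has a 0 at (i,j). In the cyclic order σ(1), ρ(1), σ(2), ρ(2), …, σ(k'), ρ(k') the non-edges are
-- precisely the consecutive pairs, so G' is the complement of C_{2k'}.
module Submission where

open import Defs hiding (sym)
open import Data.Nat using (ℕ; _≤_; _+_)
open import Data.Product using (proj₁)
open import Relation.Binary.PropositionalEquality using (_≡_)

open import Data.Bool using (Bool; true; false; not; T)
open import Data.Bool.Properties using (¬-not; not-¬; not-involutive; T-≡)
open import Data.Unit using (tt)
open import Data.Fin using (Fin; zero; suc; toℕ; inject₁; cast; combine; remQuot; _≟_)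
open import Data.Fin.Properties
  using (toℕ-inject₁; toℕ<n; toℕ-cast; toℕ-combine; cast-involutive; combine-remQuot; remQuot-combine)
open import Data.Nat using (suc; _*_)
import Data.Nat as ℕ
open import Data.Nat.Properties using (suc-injective; *-suc; *-comm; +-identityʳ; +-comm; *-cancelˡ-≡; even≢odd; <⇒≢)
open import Data.Product using (∃; _×_; _,_; proj₂; uncurry)
open import Data.Sum using (_⊎_; inj₁; inj₂)
open import Function using (_∘_; id)
open import Function.Bundles using (_⇔_; mk⇔; Equivalence)
open import Function.Definitions using (Injective)
import Function.Properties.Equivalence as ⇔
open import Relation.Nullary using (¬_; yes; no; contradiction)
open import Relation.Binary.PropositionalEquality
  using (_≢_; refl; sym; trans; cong; subst; subst₂; ≢-sym; module ≡-Reasoning)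

-- Column x of row y of M_I(k) holds a 1 (0-indexed; x ≡ suc y is impossible in the last row).
CyclicBand : ℕ → ℕ → ℕ → Set
CyclicBand k y x = x ≡ y ⊎ x ≡ suc y ⊎ (x ≡ 0 × suc y ≡ k)

MI-band : ∀ k (i j : Fin k) → T (MI k i j) → CyclicBand k (toℕ i) (toℕ j)
MI-band k i j one with suc (toℕ i) ℕ.≟ k
... | yes last with toℕ j ℕ.≟ 0 | toℕ j ℕ.≟ toℕ i
...   | yes j≡0 | _       = inj₂ (inj₂ (j≡0 , last))
...   | no _    | yes j≡i = inj₁ j≡i
MI-band k i j () | yes _ | no _ | no _
MI-band k i j one | no _ with toℕ j ℕ.≟ toℕ i | toℕ j ℕ.≟ suc (toℕ i)
...   | yes j≡i | _         = inj₁ j≡i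
...   | no _    | yes j≡1+i = inj₂ (inj₁ j≡1+i)
MI-band k i j () | no _ | no _ | no _

band-MI : ∀ k (i j : Fin k) → CyclicBand k (toℕ i) (toℕ j) → T (MI k i j)
band-MI k i j band with suc (toℕ i) ℕ.≟ k
... | yes last with toℕ j ℕ.≟ 0 | toℕ j ℕ.≟ toℕ i | band
...   | yes _  | _      | _                         = tt
...   | no _   | yes _  | _                         = tt
...   | no _   | no j≢i | inj₁ j≡i                  = contradiction j≡i j≢i
...   | no _   | no _   | inj₂ (inj₁ j≡1+i)         = contradiction (trans j≡1+i last) (<⇒≢ (toℕ<n j))
...   | no j≢0 | no _   | inj₂ (inj₂ (j≡0 , _))     = contradiction j≡0 j≢0
band-MI k i j band | no ¬last with toℕ j ℕ.≟ toℕ i | toℕ j ℕ.≟ suc (toℕ i) | band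
...   | yes _  | _        | _                       = tt
...   | no _   | yes _    | _                       = tt
...   | no j≢i | no _     | inj₁ j≡i                = contradiction j≡i j≢i
...   | no _   | no j≢1+i | inj₂ (inj₁ j≡1+i)       = contradiction j≡1+i j≢1+i
...   | no _   | no _     | inj₂ (inj₂ (_ , last))  = contradiction last ¬last

-- CycleAdj m a b unfolds to CycleAdjℕ m (toℕ a) (toℕ b).
CycleAdjℕ : ℕ → ℕ → ℕ → Set
CycleAdjℕ m x y = (y ≡ suc x) ⊎ (x ≡ suc y) ⊎ (x ≡ 0 × suc y ≡ m) ⊎ (y ≡ 0 × suc x ≡ m)

CycleAdjℕ-sym : ∀ {m x y} → CycleAdjℕ m x y → CycleAdjℕ m y x
CycleAdjℕ-sym (inj₁ e)                = inj₂ (inj₁ e)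
CycleAdjℕ-sym (inj₂ (inj₁ e))         = inj₁ e
CycleAdjℕ-sym (inj₂ (inj₂ (inj₁ e)))  = inj₂ (inj₂ (inj₂ e))
CycleAdjℕ-sym (inj₂ (inj₂ (inj₂ e)))  = inj₂ (inj₂ (inj₁ e))

CycleAdjℕ-cong : ∀ {m m′ x x′ y y′} → m ≡ m′ → x ≡ x′ → y ≡ y′ → CycleAdjℕ m x y → CycleAdjℕ m′ x′ y′
CycleAdjℕ-cong refl refl refl = id

¬CycleAdjℕ-even-even : ∀ k x y → ¬ CycleAdjℕ (2 * k) (2 * x) (2 * y)
¬CycleAdjℕ-even-even k x y (inj₁ e)                      = even≢odd y x e
¬CycleAdjℕ-even-even k x y (inj₂ (inj₁ e))               = even≢odd x y e
¬CycleAdjℕ-even-even k x y (inj₂ (inj₂ (inj₁ (_ , e))))  = even≢odd k y (sym e)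
¬CycleAdjℕ-even-even k x y (inj₂ (inj₂ (inj₂ (_ , e))))  = even≢odd k x (sym e)

¬CycleAdjℕ-odd-odd : ∀ k x y → ¬ CycleAdjℕ (2 * k) (suc (2 * x)) (suc (2 * y))
¬CycleAdjℕ-odd-odd k x y (inj₁ e)        = even≢odd y x (suc-injective e)
¬CycleAdjℕ-odd-odd k x y (inj₂ (inj₁ e)) = even≢odd x y (suc-injective e)
¬CycleAdjℕ-odd-odd k x y (inj₂ (inj₂ (inj₁ (() , _))))
¬CycleAdjℕ-odd-odd k x y (inj₂ (inj₂ (inj₂ (() , _))))

CycleAdjℕ-odd-even⇔ : ∀ k y x → CycleAdjℕ (2 * k) (suc (2 * y)) (2 * x) ⇔ CyclicBand k y x
CycleAdjℕ-odd-even⇔ k y x = mk⇔ to from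
  where
  to : CycleAdjℕ (2 * k) (suc (2 * y)) (2 * x) → CyclicBand k y x
  to (inj₁ e)                          = inj₂ (inj₁ (*-cancelˡ-≡ x (suc y) 2 (trans e (sym (*-suc 2 y)))))
  to (inj₂ (inj₁ e))                   = inj₁ (sym (*-cancelˡ-≡ y x 2 (suc-injective e)))
  to (inj₂ (inj₂ (inj₂ (e₀ , eₖ))))    =
    inj₂ (inj₂ (*-cancelˡ-≡ x 0 2 e₀ , *-cancelˡ-≡ (suc y) k 2 (trans (*-suc 2 y) eₖ)))
  from : CyclicBand k y x → CycleAdjℕ (2 * k) (suc (2 * y)) (2 * x)
  from (inj₁ refl)                 = inj₂ (inj₁ refl)
  from (inj₂ (inj₁ refl))          = inj₁ (*-suc 2 y)
  from (inj₂ (inj₂ (refl , refl))) = inj₂ (inj₂ (inj₂ (refl , sym (*-suc 2 y))))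

k*2≡k+k : ∀ k → k * 2 ≡ k + k
k*2≡k+k k = trans (*-comm k 2) (cong (k +_) (+-identityʳ k))

k+k≡2*k : ∀ k → k + k ≡ 2 * k
k+k≡2*k k = sym (trans (*-comm 2 k) (k*2≡k+k k))

-- Position 2i + p of the cyclic order.
interleave : ∀ {k} → Fin k × Fin 2 → Fin (k + k)
interleave {k} (i , p) = cast (k*2≡k+k k) (combine i p)

deinterleave : ∀ {k} → Fin (k + k) → Fin k × Fin 2
deinterleave {k} a = remQuot 2 (cast (sym (k*2≡k+k k)) a)

interleave-deinterleave : ∀ {k} (a : Fin (k + k)) → interleave {k} (deinterleave a) ≡ a
interleave-deinterleave {k} a = begin
  cast eq (uncurry combine (remQuot {k} 2 (cast (sym eq) a))) ≡⟨ cong (cast eq) (combine-remQuot {k} 2 (cast (sym eq) a)) ⟩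
  cast eq (cast (sym eq) a)                                  ≡⟨ cast-involutive eq (sym eq) a ⟩
  a                                                          ∎
  where
  open ≡-Reasoning
  eq = k*2≡k+k k

deinterleave-interleave : ∀ {k} (p : Fin k × Fin 2) → deinterleave {k} (interleave p) ≡ p
deinterleave-interleave {k} (i , p) = begin
  remQuot 2 (cast (sym eq) (cast eq (combine i p))) ≡⟨ cong (remQuot 2) (cast-involutive (sym eq) eq _) ⟩
  remQuot 2 (combine i p)                           ≡⟨ remQuot-combine i p ⟩
  (i , p)                                           ∎
  where
  open ≡-Reasoning
  eq = k*2≡k+k k

interleave-injective : ∀ {k} → Injective _≡_ _≡_ (interleave {k})
interleave-injective {k} {p} {q} e =
  trans (sym (deinterleave-interleave p)) (trans (cong (deinterleave {k}) e) (deinterleave-interleave q))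

deinterleave-injective : ∀ {k} → Injective _≡_ _≡_ (deinterleave {k})
deinterleave-injective {k} {a} {b} e =
  trans (sym (interleave-deinterleave {k} a)) (trans (cong (interleave {k}) e) (interleave-deinterleave {k} b))

toℕ-interleave : ∀ {k} (i : Fin k) p → toℕ (interleave (i , p)) ≡ 2 * toℕ i + toℕ p
toℕ-interleave {k} i p = trans (toℕ-cast (k*2≡k+k k) (combine i p)) (toℕ-combine i p)

toℕ-interleave-even : ∀ {k} (i : Fin k) → toℕ (interleave (i , zero)) ≡ 2 * toℕ i
toℕ-interleave-even i = trans (toℕ-interleave i zero) (+-identityʳ _)

toℕ-interleave-odd : ∀ {k} (i : Fin k) → toℕ (interleave (i , suc zero)) ≡ suc (2 * toℕ i)
toℕ-interleave-odd i = trans (toℕ-interleave i (suc zero)) (+-comm _ 1)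

coCycleAdj-sym : ∀ {m} {a b : Fin m} → CoCycleAdj m a b → CoCycleAdj m b a
coCycleAdj-sym (a≢b , ¬adj) = ≢-sym a≢b , ¬adj ∘ CycleAdjℕ-sym

coCycleAdj-sym⇔ : ∀ {m} {a b : Fin m} → CoCycleAdj m a b ⇔ CoCycleAdj m b a
coCycleAdj-sym⇔ = mk⇔ coCycleAdj-sym coCycleAdj-sym

-- Side zero: even positions of the cycle (the σ(j)); side one: odd positions (the ρ(i)).
CoCycleOnSides : ∀ k → Fin k × Fin 2 → Fin k × Fin 2 → Set
CoCycleOnSides k (i , zero)     (j , zero)     = i ≢ j
CoCycleOnSides k (i , suc zero) (j , suc zero) = i ≢ j
CoCycleOnSides k (i , suc zero) (j , zero)     = ¬ CyclicBand k (toℕ i) (toℕ j)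
CoCycleOnSides k (i , zero)     (j , suc zero) = ¬ CyclicBand k (toℕ j) (toℕ i)

coCycleAdj-sameSide⇔ : ∀ {k} (i j : Fin k) p →
  ¬ CycleAdj (k + k) (interleave (i , p)) (interleave (j , p)) →
  CoCycleAdj (k + k) (interleave (i , p)) (interleave (j , p)) ⇔ i ≢ j
coCycleAdj-sameSide⇔ i j p ¬adj = mk⇔
  (λ (a≢b , _) i≡j → a≢b (cong (λ i → interleave (i , p)) i≡j))
  (λ i≢j → i≢j ∘ cong proj₁ ∘ interleave-injective , ¬adj)

coCycleAdj-odd-even⇔ : ∀ {k} (i j : Fin k) →
  CoCycleAdj (k + k) (interleave (i , suc zero)) (interleave (j , zero)) ⇔ (¬ CyclicBand k (toℕ i) (toℕ j))
coCycleAdj-odd-even⇔ {k} i j = mk⇔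
  (λ (_ , ¬adj) → ¬adj ∘ from-ℕ ∘ Equivalence.from band⇔)
  (λ ¬band → (λ e → contradiction (cong proj₂ (interleave-injective {k} e)) λ ()) , ¬band ∘ Equivalence.to band⇔ ∘ to-ℕ)
  where
  a = interleave (i , suc zero)
  b = interleave (j , zero)
  band⇔ : CycleAdjℕ (2 * k) (suc (2 * toℕ i)) (2 * toℕ j) ⇔ CyclicBand k (toℕ i) (toℕ j)
  band⇔ = CycleAdjℕ-odd-even⇔ k (toℕ i) (toℕ j)
  to-ℕ : CycleAdj (k + k) a b → CycleAdjℕ (2 * k) (suc (2 * toℕ i)) (2 * toℕ j)
  to-ℕ = CycleAdjℕ-cong (k+k≡2*k k) (toℕ-interleave-odd i) (toℕ-interleave-even j)
  from-ℕ : CycleAdjℕ (2 * k) (suc (2 * toℕ i)) (2 * toℕ j) → CycleAdj (k + k) a b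
  from-ℕ = CycleAdjℕ-cong (sym (k+k≡2*k k)) (sym (toℕ-interleave-odd i)) (sym (toℕ-interleave-even j))

coCycleAdj-interleave⇔ : ∀ {k} p q →
  CoCycleAdj (k + k) (interleave p) (interleave q) ⇔ CoCycleOnSides k p q
coCycleAdj-interleave⇔ {k} (i , zero) (j , zero) = coCycleAdj-sameSide⇔ i j zero
  (¬CycleAdjℕ-even-even k (toℕ i) (toℕ j)
    ∘ CycleAdjℕ-cong (k+k≡2*k k) (toℕ-interleave-even i) (toℕ-interleave-even j))
coCycleAdj-interleave⇔ {k} (i , suc zero) (j , suc zero) = coCycleAdj-sameSide⇔ i j (suc zero)
  (¬CycleAdjℕ-odd-odd k (toℕ i) (toℕ j)
    ∘ CycleAdjℕ-cong (k+k≡2*k k) (toℕ-interleave-odd i) (toℕ-interleave-odd j))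
coCycleAdj-interleave⇔ (i , suc zero) (j , zero) = coCycleAdj-odd-even⇔ i j
coCycleAdj-interleave⇔ (i , zero) (j , suc zero) = ⇔.trans coCycleAdj-sym⇔ (coCycleAdj-odd-even⇔ j i)

inducedIsoCoCycle-fromSides : ∀ {n k} (G : Graph n) (S : Fin n → Set) (vertex : Fin k × Fin 2 → Fin n) →
  Injective _≡_ _≡_ vertex →
  (∀ v → S v ⇔ (∃ λ p → vertex p ≡ v)) →
  (∀ p q → T (adj G (vertex p) (vertex q)) ⇔ CoCycleOnSides k p q) →
  InducedIsoCoCycle G S (k + k)
inducedIsoCoCycle-fromSides {k = k} G S vertex vertex-injective vertex-image vertex-adj⇔ =
  vertex ∘ deinterleave , deinterleave-injective ∘ vertex-injective , image , adjacency
  where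
  image : ∀ v → S v ⇔ (∃ λ a → vertex (deinterleave a) ≡ v)
  image v = ⇔.trans (vertex-image v) (mk⇔
    (λ (p , e) → interleave p , trans (cong vertex (deinterleave-interleave p)) e)
    (λ (a , e) → deinterleave a , e))
  adjacency : ∀ a b → T (adj G (vertex (deinterleave a)) (vertex (deinterleave b))) ⇔ CoCycleAdj (k + k) a b
  adjacency a b = ⇔.trans (vertex-adj⇔ (deinterleave a) (deinterleave b)) (⇔.sym
    (subst₂ (λ x y → CoCycleAdj (k + k) x y ⇔ CoCycleOnSides k (deinterleave a) (deinterleave b))
      (interleave-deinterleave {k} a) (interleave-deinterleave {k} b)
      (coCycleAdj-interleave⇔ (deinterleave a) (deinterleave b))))

augAdj≡false : ∀ {n} (G : Graph n) {u v} → augAdj G u v ≡ false → u ≢ v × adj G u v ≡ false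
augAdj≡false G {u} {v} eq with u ≟ v
... | no u≢v = u≢v , eq

augAdj≡true : ∀ {n} (G : Graph n) {u v} → augAdj G u v ≡ true → u ≢ v → adj G u v ≡ true
augAdj≡true G {u} {v} eq u≢v with u ≟ v
... | yes u≡v = contradiction u≡v u≢v
... | no _    = eq

adj⇔≢-onClique : ∀ {n k} (G : Graph n) (f : Fin k → Fin n) →
  (∀ i j → i ≢ j → adj G (f i) (f j) ≡ true) →
  ∀ i j → T (adj G (f i) (f j)) ⇔ i ≢ j
adj⇔≢-onClique G f clique i j = mk⇔
  (λ { edge refl → subst T (irrefl G (f i)) edge })
  (λ i≢j → Equivalence.from T-≡ (clique i j i≢j))

consecutive-constant : ∀ {a} {A : Set a} {k} (f : Fin k → A) →
  (∀ i j → toℕ j ≡ suc (toℕ i) → f j ≡ f i) → ∀ i j → f i ≡ f j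
consecutive-constant {A = A} {suc k} f step i j = trans (to-zero f step′ i) (sym (to-zero f step′ j))
  where
  step′ : ∀ i → f (suc i) ≡ f (inject₁ i)
  step′ i = step (inject₁ i) (suc i) (cong suc (sym (toℕ-inject₁ i)))
  to-zero : ∀ {k} (g : Fin (suc k) → A) → (∀ i → g (suc i) ≡ g (inject₁ i)) → ∀ i → g i ≡ g zero
  to-zero g g-step zero = refl
  to-zero {suc k} g g-step (suc i) = trans (g-step i) (to-zero (g ∘ inject₁) (g-step ∘ inject₁) i)

module ColourClasses {n} (G : Graph n) {k} {ρ σ : Fin k → Fin n}
  (ρ-injective : Injective _≡_ _≡_ ρ) (σ-injective : Injective _≡_ _≡_ σ)
  (M≡ : ∀ i j → augAdj G (ρ i) (σ j) ≡ not (MI k i j))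
  {c : Fin n → Bool}
  (c-proper : ∀ u v → InImage ρ σ u → InImage ρ σ v → u ≢ v → adj G u v ≡ false → c u ≢ c v)
  where

  MI-one⇒non-edge : ∀ i j → T (MI k i j) → ρ i ≢ σ j × adj G (ρ i) (σ j) ≡ false
  MI-one⇒non-edge i j one = augAdj≡false G (trans (M≡ i j) (cong not (Equivalence.to T-≡ one)))

  MI-one⇒opposite : ∀ i j → T (MI k i j) → c (σ j) ≡ not (c (ρ i))
  MI-one⇒opposite i j one =
    ¬-not (≢-sym (c-proper (ρ i) (σ j) (inj₁ (i , refl)) (inj₂ (j , refl)) ρi≢σj non-edge))
    where
    ρi≢σj : ρ i ≢ σ j
    ρi≢σj = proj₁ (MI-one⇒non-edge i j one)
    non-edge : adj G (ρ i) (σ j) ≡ false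
    non-edge = proj₂ (MI-one⇒non-edge i j one)

  ρ-monochromatic : ∀ i j → c (ρ i) ≡ c (ρ j)
  ρ-monochromatic = consecutive-constant (c ∘ ρ) step
    where
    open ≡-Reasoning
    step : ∀ i j → toℕ j ≡ suc (toℕ i) → c (ρ j) ≡ c (ρ i)
    step i j j≡1+i = begin
      c (ρ j)             ≡⟨ not-involutive _ ⟨
      not (not (c (ρ j))) ≡⟨ cong not (MI-one⇒opposite j j (band-MI k j j (inj₁ refl))) ⟨
      not (c (σ j))       ≡⟨ cong not (MI-one⇒opposite i j (band-MI k i j (inj₂ (inj₁ j≡1+i)))) ⟩
      not (not (c (ρ i))) ≡⟨ not-involutive _ ⟩
      c (ρ i)             ∎

  σ-opposite : ∀ i j → c (σ j) ≡ not (c (ρ i))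
  σ-opposite i j = trans (MI-one⇒opposite j j (band-MI k j j (inj₁ refl))) (cong not (ρ-monochromatic j i))

  σ-monochromatic : ∀ i j → c (σ i) ≡ c (σ j)
  σ-monochromatic i j = trans (σ-opposite i i) (sym (σ-opposite i j))

  ρ≢σ : ∀ i j → ρ i ≢ σ j
  ρ≢σ i j ρi≡σj = not-¬ refl (trans (cong c ρi≡σj) (σ-opposite i j))

  ρ-clique : ∀ i j → i ≢ j → adj G (ρ i) (ρ j) ≡ true
  ρ-clique i j i≢j = ¬-not λ non-edge →
    c-proper (ρ i) (ρ j) (inj₁ (i , refl)) (inj₁ (j , refl)) (i≢j ∘ ρ-injective) non-edge (ρ-monochromatic i j)

  σ-clique : ∀ i j → i ≢ j → adj G (σ i) (σ j) ≡ true
  σ-clique i j i≢j = ¬-not λ non-edge →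
    c-proper (σ i) (σ j) (inj₂ (i , refl)) (inj₂ (j , refl)) (i≢j ∘ σ-injective) non-edge (σ-monochromatic i j)

  ρσ-edge⇔ : ∀ i j → adj G (ρ i) (σ j) ≡ true ⇔ (¬ CyclicBand k (toℕ i) (toℕ j))
  ρσ-edge⇔ i j = mk⇔
    (λ edge band → not-¬ edge (proj₂ (MI-one⇒non-edge i j (band-MI k i j band))))
    (λ ¬band → augAdj≡true G (trans (M≡ i j) (cong not (MI-zero ¬band))) (ρ≢σ i j))
    where
    MI-zero : ¬ CyclicBand k (toℕ i) (toℕ j) → MI k i j ≡ false
    MI-zero ¬band = ¬-not (¬band ∘ MI-band k i j ∘ Equivalence.from T-≡)

  vertex : Fin k × Fin 2 → Fin n
  vertex (i , zero)     = σ i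
  vertex (i , suc zero) = ρ i

  vertex-injective : Injective _≡_ _≡_ vertex
  vertex-injective {i , zero}     {j , zero}     e = cong (_, zero) (σ-injective e)
  vertex-injective {i , zero}     {j , suc zero} e = contradiction (sym e) (ρ≢σ j i)
  vertex-injective {i , suc zero} {j , zero}     e = contradiction e (ρ≢σ i j)
  vertex-injective {i , suc zero} {j , suc zero} e = cong (_, suc zero) (ρ-injective e)

  vertex-image : ∀ v → InImage ρ σ v ⇔ (∃ λ p → vertex p ≡ v)
  vertex-image v = mk⇔ to from
    where
    to : InImage ρ σ v → ∃ λ p → vertex p ≡ v
    to (inj₁ (i , e)) = (i , suc zero) , e
    to (inj₂ (j , e)) = (j , zero) , e
    from : (∃ λ p → vertex p ≡ v) → InImage ρ σ v
    from ((i , zero) , e)     = inj₂ (i , e)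
    from ((i , suc zero) , e) = inj₁ (i , e)

  vertex-adj⇔ : ∀ p q → T (adj G (vertex p) (vertex q)) ⇔ CoCycleOnSides k p q
  vertex-adj⇔ (i , zero)     (j , zero)     = adj⇔≢-onClique G σ σ-clique i j
  vertex-adj⇔ (i , suc zero) (j , suc zero) = adj⇔≢-onClique G ρ ρ-clique i j
  vertex-adj⇔ (i , suc zero) (j , zero)     = ⇔.trans T-≡ (ρσ-edge⇔ i j)
  vertex-adj⇔ (i , zero)     (j , suc zero) =
    subst (λ b → T b ⇔ (¬ CyclicBand k (toℕ j) (toℕ i))) (Graph.sym G (ρ j) (σ i)) (vertex-adj⇔ (j , suc zero) (i , zero))

lemma29 : ∀ {n} (G : Graph n) (k : ℕ) → 3 ≤ k →
    (ρ σ : RowMap k n) →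
    (∀ i j → subMatrix (augAdj G) (proj₁ ρ) (proj₁ σ) i j ≡ compl (MI k) i j) →
    CoBipartiteOn G (InImage (proj₁ ρ) (proj₁ σ)) →
    InducedIsoCoCycle G (InImage (proj₁ ρ) (proj₁ σ)) (k + k)
lemma29 G k _ (ρ , ρ-injective) (σ , σ-injective) M≡ (c , c-proper) =
  inducedIsoCoCycle-fromSides G (InImage ρ σ) vertex vertex-injective vertex-image vertex-adj⇔
  where open ColourClasses G ρ-injective σ-injective M≡ c-proper
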